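{- If $\mathsf{m}\ell\mathsf{IKt}2\vdash\mathcal R\mid\Gamma\Rightarrow\Delta$, then there is some $w:A\in\Delta$ such that $\ell\mathsf{IKt}2\vdash\mathcal R\mid\Gamma\Rightarrow w:A$. Likewise, if $\mathsf{m}\ell\mathsf{IKt}2\setminus\mathsf{cut}\vdash\mathcal R\mid\Gamma\Rightarrow\Delta$, then there is some $w:A\in\Delta$ such that $\ell\mathsf{IKt}2\setminus\mathsf{cut}\vdash\mathcal R\mid\Gamma\Rightarrow w:A$.
   Context: Formulas: $A ::= P \mid X \mid A\to B \mid \Box A \mid \blacksquare A \mid \forall X A$ over propositional symbols $P$ and second-order variables $X$; $A[C/X]$ capture-avoiding substitution. Labelled sequents: world symbols; relational atoms $vRw$; labelled formulas $v:A$ with $A$ closed; sequents $\mathcal R\mid\Gamma\Rightarrow\Delta$ with $\mathcal R$ a set of relational atoms and $\Gamma,\Delta$ finite multisets of labelled formulas. $\ell\mathsf{Kt}2$ rules (fresh = not occurring in the conclusion): id: $\mathcal R\mid v:A\Rightarrow v:A$; cut: from $\mathcal R\mid\Gamma\Rightarrow\Delta,v:A$ and $\mathcal R\mid\Gamma',v:A\Rightarrow\Delta'$ infer $\mathcal R\mid\Gamma,\Gamma'\Rightarrow\Delta,\Delta'$; weakening and contraction on left and right; $\to$L: from $\mathcal R\mid\Gamma\Rightarrow\Delta,v:A$ and $\mathcal R\mid\Gamma',v:B\Rightarrow\Delta'$ infer $\mathcal R\mid\Gamma,\Gamma',v:A\to B\Rightarrow\Delta,\Delta'$; $\to$R: from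 $\mathcal R\mid\Gamma,v:A\Rightarrow\Delta,v:B$ infer $\mathcal R\mid\Gamma\Rightarrow\Delta,v:A\to B$; $\forall$L: from $\mathcal R\mid\Gamma,v:A[C/X]\Rightarrow\Delta$ infer $\mathcal R\mid\Gamma,v:\forall XA\Rightarrow\Delta$ (any closed $C$); $\forall$R: from $\mathcal R\mid\Gamma\Rightarrow\Delta,v:A[P/X]$ infer $\mathcal R\mid\Gamma\Rightarrow\Delta,v:\forall XA$, $P$ fresh; $\Box$L: from $\mathcal R,vRw\mid\Gamma,w:A\Rightarrow\Delta$ infer $\mathcal R,vRw\mid\Gamma,v:\Box A\Rightarrow\Delta$; $\Box$R: from $\mathcal R,vRw\mid\Gamma\Rightarrow\Delta,w:A$ infer $\mathcal R\mid\Gamma\Rightarrow\Delta,v:\Box A$, $w$ fresh; $\blacksquare$L: from $\mathcal R,uRv\mid\Gamma,u:A\Rightarrow\Delta$ infer $\mathcal R,uRv\mid\Gamma,v:\blacksquare A\Rightarrow\Delta$; $\blacksquare$R: from $\mathcal R,uRv\mid\Gamma\Rightarrow\Delta,u:A$ infer $\mathcal R\mid\Gamma\Rightarrow\Delta,v:\blacksquare A$, $u$ fresh. $\ell\mathsf{IKt}2$: restriction of $\ell\mathsf{Kt}2$ to sequents with singleton right-hand side. $\mathsf{m}\ell\mathsf{IKt}2$: restriction of $\ell\mathsf{Kt}2$ in which every right logical step ($\to$R, $\forall$R, $\Box$R, $\blacksquare$R) has $\Delta=\emptyset$ (so its premiss has a singleton right-hand side). $\mathsf L\setminus\mathsf{cut}$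 is $\mathsf L$ without cut. -}

module Defs where

open import Data.Nat using (ℕ; suc)
open import Data.Fin using (Fin; zero; suc; punchOut; _≟_)
open import Data.List using (List; []; _∷_; _++_; [_]; length)
open import Data.List.Membership.Propositional using (_∈_; _∉_)
open import Data.List.Relation.Unary.Any using (Any)
open import Data.List.Relation.Binary.Permutation.Propositional using (_↭_)
open import Data.Product using (_×_; _,_; Σ)
open import Data.Unit using (⊤)
open import Relation.Nullary using (¬_; yes; no)
open import Relation.Binary.PropositionalEquality using (_≡_)

-- Second-order formulas, de Bruijn style: Form n has n free
-- second-order variables; closed formulas are Form 0.
-- Propositional symbols are natural numbers.

data Form (n : ℕ) : Set where
  atom : ℕ → Form n
  var  : Fin n → Form n
  _⊃_  : Form n → Form n → Form n
  □    : Form n → Form n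
  ■    : Form n → Form n
  ∀̇    : Form (suc n) → Form n

infixr 7 _⊃_

lift : ∀ {m n} → (Fin m → Fin n) → Fin (suc m) → Fin (suc n)
lift ρ zero    = zero
lift ρ (suc i) = suc (ρ i)

ren : ∀ {m n} → (Fin m → Fin n) → Form m → Form n
ren ρ (atom P) = atom P
ren ρ (var i)  = var (ρ i)
ren ρ (A ⊃ B)  = ren ρ A ⊃ ren ρ B
ren ρ (□ A)    = □ (ren ρ A)
ren ρ (■ A)    = ■ (ren ρ A)
ren ρ (∀̇ A)    = ∀̇ (ren (lift ρ) A)

closed : ∀ {n} → Form 0 → Form n
closed = ren (λ ())

sub : ∀ {n} → Fin (suc n) → Form 0 → Form (suc n) → Form n
sub k C (atom P) = atom P
sub k C (var j) with k ≟ j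
... | yes _  = closed C
... | no k≢j = var (punchOut k≢j)
sub k C (A ⊃ B) = sub k C A ⊃ sub k C B
sub k C (□ A)   = □ (sub k C A)
sub k C (■ A)   = ■ (sub k C A)
sub k C (∀̇ A)   = ∀̇ (sub (suc k) C A)

inst : Form 1 → Form 0 → Form 0
inst A C = sub zero C A

World : Set
World = ℕ

Rel : Set
Rel = World × World

record LF : Set where
  constructor _∶_
  field
    world : World
    form  : Form 0

infix 6 _∶_

data OccF {n : ℕ} (P : ℕ) : Form n → Set where
  atm : OccF P (atom P)
  ⊃₁  : ∀ {A B} → OccF P A → OccF P (A ⊃ B)
  ⊃₂  : ∀ {A B} → OccF P B → OccF P (A ⊃ B)
  □o  : ∀ {A} → OccF P A → OccF P (□ A)
  ■o  : ∀ {A} → OccF P A → OccF P (■ A)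
  ∀o  : ∀ {A} → OccF P A → OccF P (∀̇ A)

OccL : ℕ → List LF → Set
OccL P Γ = Any (λ x → OccF P (LF.form x)) Γ

-- P does not occur in the sequent R | Γ ⇒ Δ (R contains no formulas)
FreshP : ℕ → List LF → List LF → Set
FreshP P Γ Δ = ¬ OccL P Γ × ¬ OccL P Δ

OccR : World → List Rel → Set
OccR w R = Any (λ r → (Data.Product.proj₁ r ≡ w) Data.Sum.⊎ (Data.Product.proj₂ r ≡ w)) R
  where import Data.Product; import Data.Sum

OccW : World → List LF → Set
OccW w Γ = Any (λ x → LF.world x ≡ w) Γ

FreshW : World → List Rel → List LF → List LF → Set
FreshW w R Γ Δ = ¬ OccR w R × ¬ OccW w Γ × ¬ OccW w Δ

-- R is represented as a list, which
-- the rules only consult via membership, so it behaves as a set.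
-- Γ, Δ are lists read as multisets: an explicit exchange step `ex`
-- identifies lists up to permutation.

data Deriv : List Rel → List LF → List LF → Set where
  id  : ∀ {R v A} → Deriv R [ v ∶ A ] [ v ∶ A ]
  cut : ∀ {R Γ Γ' Δ Δ' v A} →
        Deriv R Γ (v ∶ A ∷ Δ) → Deriv R (v ∶ A ∷ Γ') Δ' →
        Deriv R (Γ ++ Γ') (Δ ++ Δ')
  wL  : ∀ {R Γ Δ} x → Deriv R Γ Δ → Deriv R (x ∷ Γ) Δ
  wR  : ∀ {R Γ Δ} x → Deriv R Γ Δ → Deriv R Γ (x ∷ Δ)
  cL  : ∀ {R Γ Δ x} → Deriv R (x ∷ x ∷ Γ) Δ → Deriv R (x ∷ Γ) Δ
  cR  : ∀ {R Γ Δ x} → Deriv R Γ (x ∷ x ∷ Δ) → Deriv R Γ (x ∷ Δ)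
  ex  : ∀ {R Γ Γ' Δ Δ'} → Deriv R Γ Δ → Γ ↭ Γ' → Δ ↭ Δ' → Deriv R Γ' Δ'
  ⊃L  : ∀ {R Γ Γ' Δ Δ' v A B} →
        Deriv R Γ (v ∶ A ∷ Δ) → Deriv R (v ∶ B ∷ Γ') Δ' →
        Deriv R (v ∶ A ⊃ B ∷ Γ ++ Γ') (Δ ++ Δ')
  ⊃R  : ∀ {R Γ Δ v A B} →
        Deriv R (v ∶ A ∷ Γ) (v ∶ B ∷ Δ) → Deriv R Γ (v ∶ A ⊃ B ∷ Δ)
  ∀L  : ∀ {R Γ Δ v A} (C : Form 0) →
        Deriv R (v ∶ inst A C ∷ Γ) Δ → Deriv R (v ∶ ∀̇ A ∷ Γ) Δ
  ∀R  : ∀ {R Γ Δ v A} (P : ℕ) → FreshP P Γ (v ∶ ∀̇ A ∷ Δ) →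
        Deriv R Γ (v ∶ inst A (atom P) ∷ Δ) → Deriv R Γ (v ∶ ∀̇ A ∷ Δ)
  □L  : ∀ {R Γ Δ v w A} → (v , w) ∈ R →
        Deriv R (w ∶ A ∷ Γ) Δ → Deriv R (v ∶ □ A ∷ Γ) Δ
  □R  : ∀ {R Γ Δ v A} (w : World) → FreshW w R Γ (v ∶ □ A ∷ Δ) →
        Deriv ((v , w) ∷ R) Γ (w ∶ A ∷ Δ) → Deriv R Γ (v ∶ □ A ∷ Δ)
  ■L  : ∀ {R Γ Δ u v A} → (u , v) ∈ R →
        Deriv R (u ∶ A ∷ Γ) Δ → Deriv R (v ∶ ■ A ∷ Γ) Δ
  ■R  : ∀ {R Γ Δ v A} (u : World) → FreshW u R Γ (v ∶ ■ A ∷ Δ) →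
        Deriv ((u , v) ∷ R) Γ (u ∶ A ∷ Δ) → Deriv R Γ (v ∶ ■ A ∷ Δ)

CutFree : ∀ {R Γ Δ} → Deriv R Γ Δ → Set
CutFree id          = ⊤
CutFree (cut _ _)   = Data.Empty.⊥  where import Data.Empty
CutFree (wL _ d)    = CutFree d
CutFree (wR _ d)    = CutFree d
CutFree (cL d)      = CutFree d
CutFree (cR d)      = CutFree d
CutFree (ex d _ _)  = CutFree d
CutFree (⊃L d e)    = CutFree d × CutFree e
CutFree (⊃R d)      = CutFree d
CutFree (∀L _ d)    = CutFree d
CutFree (∀R _ _ d)  = CutFree d
CutFree (□L _ d)    = CutFree d
CutFree (□R _ _ d)  = CutFree d
CutFree (■L _ d)    = CutFree d
CutFree (■R _ _ d)  = CutFree d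

-- ℓIKt2 : every sequent in the derivation has a singleton right-hand side
Single : ∀ {R Γ Δ} → Deriv R Γ Δ → Set
Single {Δ = Δ} d = length Δ ≡ 1 × go d
  where
  go : ∀ {R Γ Δ} → Deriv R Γ Δ → Set
  go id          = ⊤
  go (cut d e)   = Single d × Single e
  go (wL _ d)    = Single d
  go (wR _ d)    = Single d
  go (cL d)      = Single d
  go (cR d)      = Single d
  go (ex d _ _)  = Single d
  go (⊃L d e)    = Single d × Single e
  go (⊃R d)      = Single d
  go (∀L _ d)    = Single d
  go (∀R _ _ d)  = Single d
  go (□L _ d)    = Single d
  go (□R _ _ d)  = Single d
  go (■L _ d)    = Single d
  go (■R _ _ d)  = Single d

-- mℓIKt2 : every right logical step has Δ = ∅
Minimal : ∀ {R Γ Δ} → Deriv R Γ Δ → Set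
Minimal id                    = ⊤
Minimal (cut d e)             = Minimal d × Minimal e
Minimal (wL _ d)              = Minimal d
Minimal (wR _ d)              = Minimal d
Minimal (cL d)                = Minimal d
Minimal (cR d)                = Minimal d
Minimal (ex d _ _)            = Minimal d
Minimal (⊃L d e)              = Minimal d × Minimal e
Minimal (⊃R {Δ = Δ} d)        = Δ ≡ [] × Minimal d
Minimal (∀L _ d)              = Minimal d
Minimal (∀R {Δ = Δ} _ _ d)    = Δ ≡ [] × Minimal d
Minimal (□L _ d)              = Minimal d
Minimal (□R {Δ = Δ} _ _ d)    = Δ ≡ [] × Minimal d
Minimal (■L _ d)              = Minimal d
Minimal (■R {Δ = Δ} _ _ d)    = Δ ≡ [] × Minimal d

-- In a minimal derivation only left rules, structural rules and cut ever act
-- on a sequent with several formulas on the right, and none of them looks at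
-- the extra right formulas.  So by induction on the derivation one follows a
-- single right formula: the one a right rule introduced (or the axiom), with
-- the context grown by weakening where a two-premiss rule discards the branch
-- that does not carry it.  Cuts are only created where the original had one,
-- so cut-freeness is preserved.
module Submission where

open import Defs
open import Data.List using (List; [_]; []; _∷_; _++_)
open import Data.List.Membership.Propositional using (_∈_)
open import Data.List.Membership.Propositional.Properties using (∈-++⁺ˡ; ∈-++⁺ʳ)
open import Data.List.Relation.Unary.Any using (here; there)
open import Data.List.Relation.Binary.Permutation.Propositional using (↭-refl)
open import Data.List.Relation.Binary.Permutation.Propositional.Properties using (∈-resp-↭; ++-comm)
open import Data.Product using (_×_; Σ; Σ-syntax; _,_; proj₁)
open import Data.Unit using (tt)
open import Function using (_∘_)
open import Relation.Binary.PropositionalEquality using (refl)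

-- A single-conclusion derivation of R | Γ ⇒ x that is cut-free whenever the
-- condition h holds; h is instantiated with the cut-freeness of the
-- derivation it is extracted from, so one induction yields both halves.
record SingleDeriv (h : Set) (R : List Rel) (Γ : List LF) (x : LF) : Set where
  constructor ⟨_,_,_⟩
  field
    deriv   : Deriv R Γ [ x ]
    single  : Single deriv
    cutFree : h → CutFree deriv

mapCondition : ∀ {h h′ R Γ x} → (h′ → h) → SingleDeriv h R Γ x → SingleDeriv h′ R Γ x
mapCondition f ⟨ d , s , c ⟩ = ⟨ d , s , c ∘ f ⟩

weakenˡ : ∀ {h R Γ x} (Γ′ : List LF) → SingleDeriv h R Γ x → SingleDeriv h R (Γ′ ++ Γ) x
weakenˡ []       d = d
weakenˡ (y ∷ Γ′) d with weakenˡ Γ′ d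
... | ⟨ d′ , s , c ⟩ = ⟨ wL y d′ , (refl , s) , c ⟩

weakenʳ : ∀ {h R Γ x} (Γ′ : List LF) → SingleDeriv h R Γ x → SingleDeriv h R (Γ ++ Γ′) x
weakenʳ {Γ = Γ} Γ′ d with weakenˡ Γ′ d
... | ⟨ d′ , s , c ⟩ = ⟨ ex d′ (++-comm Γ′ Γ) ↭-refl , (refl , s) , c ⟩

SingleConclusion : ∀ {R Γ Δ} → Deriv R Γ Δ → Set
SingleConclusion {R} {Γ} {Δ} d = Σ[ x ∈ LF ] x ∈ Δ × SingleDeriv (CutFree d) R Γ x

minimal⇒singleConclusion : ∀ {R Γ Δ} (d : Deriv R Γ Δ) → Minimal d → SingleConclusion d
minimal⇒singleConclusion id _ = _ , here refl , ⟨ id , (refl , tt) , (λ c → c) ⟩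
minimal⇒singleConclusion (cut {Γ' = Γ′} {Δ = Δ} d e) (md , me)
  with minimal⇒singleConclusion d md
... | x , there x∈Δ , d′ = x , ∈-++⁺ˡ x∈Δ , mapCondition (λ ()) (weakenʳ Γ′ d′)
... | _ , here refl , ⟨ d′ , s , _ ⟩ with minimal⇒singleConclusion e me
...   | y , y∈Δ′ , ⟨ e′ , t , _ ⟩ =
        y , ∈-++⁺ʳ Δ y∈Δ′ , ⟨ cut d′ e′ , (refl , s , t) , (λ ()) ⟩
minimal⇒singleConclusion (⊃L {Γ' = Γ′} {Δ = Δ} {v = v} {A = A} {B = B} d e) (md , me)
  with minimal⇒singleConclusion d md
... | x , there x∈Δ , d′ with mapCondition proj₁ (weakenʳ Γ′ d′)
...   | ⟨ d″ , s , c ⟩ = x , ∈-++⁺ˡ x∈Δ , ⟨ wL (v ∶ A ⊃ B) d″ , (refl , s) , c ⟩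
minimal⇒singleConclusion (⊃L {Δ = Δ} d e) (md , me)
    | _ , here refl , ⟨ d′ , s , c ⟩ with minimal⇒singleConclusion e me
...   | y , y∈Δ′ , ⟨ e′ , t , c′ ⟩ =
        y , ∈-++⁺ʳ Δ y∈Δ′ , ⟨ ⊃L d′ e′ , (refl , s , t) , (λ (cd , ce) → c cd , c′ ce) ⟩
minimal⇒singleConclusion (wL x d) m with minimal⇒singleConclusion d m
... | y , y∈ , ⟨ d′ , s , c ⟩ = y , y∈ , ⟨ wL x d′ , (refl , s) , c ⟩
minimal⇒singleConclusion (wR x d) m with minimal⇒singleConclusion d m
... | y , y∈ , d′ = y , there y∈ , d′
minimal⇒singleConclusion (cL d) m with minimal⇒singleConclusion d m
... | y , y∈ , ⟨ d′ , s , c ⟩ = y , y∈ , ⟨ cL d′ , (refl , s) , c ⟩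
minimal⇒singleConclusion (cR d) m with minimal⇒singleConclusion d m
... | y , here refl , d′ = y , here refl , d′
... | y , there y∈ , d′ = y , y∈ , d′
minimal⇒singleConclusion (ex d p q) m with minimal⇒singleConclusion d m
... | y , y∈ , ⟨ d′ , s , c ⟩ = y , ∈-resp-↭ q y∈ , ⟨ ex d′ p ↭-refl , (refl , s) , c ⟩
minimal⇒singleConclusion (∀L C d) m with minimal⇒singleConclusion d m
... | y , y∈ , ⟨ d′ , s , c ⟩ = y , y∈ , ⟨ ∀L C d′ , (refl , s) , c ⟩
minimal⇒singleConclusion (□L r d) m with minimal⇒singleConclusion d m
... | y , y∈ , ⟨ d′ , s , c ⟩ = y , y∈ , ⟨ □L r d′ , (refl , s) , c ⟩
minimal⇒singleConclusion (■L r d) m with minimal⇒singleConclusion d m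
... | y , y∈ , ⟨ d′ , s , c ⟩ = y , y∈ , ⟨ ■L r d′ , (refl , s) , c ⟩
minimal⇒singleConclusion (⊃R d) (refl , m) with minimal⇒singleConclusion d m
... | _ , here refl , ⟨ d′ , s , c ⟩ = _ , here refl , ⟨ ⊃R d′ , (refl , s) , c ⟩
... | _ , there () , _
minimal⇒singleConclusion (∀R P f d) (refl , m) with minimal⇒singleConclusion d m
... | _ , here refl , ⟨ d′ , s , c ⟩ = _ , here refl , ⟨ ∀R P f d′ , (refl , s) , c ⟩
... | _ , there () , _
minimal⇒singleConclusion (□R w f d) (refl , m) with minimal⇒singleConclusion d m
... | _ , here refl , ⟨ d′ , s , c ⟩ = _ , here refl , ⟨ □R w f d′ , (refl , s) , c ⟩
... | _ , there () , _
minimal⇒singleConclusion (■R u f d) (refl , m) with minimal⇒singleConclusion d m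
... | _ , here refl , ⟨ d′ , s , c ⟩ = _ , here refl , ⟨ ■R u f d′ , (refl , s) , c ⟩
... | _ , there () , _

lemma4p3 :
    (∀ {R Γ Δ} (d : Deriv R Γ Δ) → Minimal d →
      Σ LF (λ x → x ∈ Δ × Σ (Deriv R Γ [ x ]) Single))
    ×
    (∀ {R Γ Δ} (d : Deriv R Γ Δ) → Minimal d → CutFree d →
      Σ LF (λ x → x ∈ Δ × Σ (Deriv R Γ [ x ]) (λ d′ → Single d′ × CutFree d′)))
lemma4p3 = intuitionistic , intuitionistic-cutFree
  where
  intuitionistic : ∀ {R Γ Δ} (d : Deriv R Γ Δ) → Minimal d →
                   Σ LF (λ x → x ∈ Δ × Σ (Deriv R Γ [ x ]) Single)
  intuitionistic d m with minimal⇒singleConclusion d m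
  ... | x , x∈Δ , ⟨ d′ , s , _ ⟩ = x , x∈Δ , d′ , s

  intuitionistic-cutFree : ∀ {R Γ Δ} (d : Deriv R Γ Δ) → Minimal d → CutFree d →
                           Σ LF (λ x → x ∈ Δ × Σ (Deriv R Γ [ x ]) (λ d′ → Single d′ × CutFree d′))
  intuitionistic-cutFree d m cf with minimal⇒singleConclusion d m
  ... | x , x∈Δ , ⟨ d′ , s , c ⟩ = x , x∈Δ , d′ , s , c cf
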